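{- Let $\mathcal{G}=([n],\mathcal{E},\mathcal{A})$ be a weight balanced directed weighted graph with loopy Laplacian $\mathcal{Q}$, and let $\alpha\subsetneq[n]$ with $|\alpha|\ge2$ be such that $\mathcal{Q}[\alpha^c,\alpha^c]$ is nonsingular. Suppose $\mathcal{A}_{ii}=0$ for all $i\in\alpha^c$. Then the Kron-reduced graph $\mathcal{G}_{\mathrm{red}}$, i.e. the graph on node set $\alpha$ whose loopy Laplacian is $\mathcal{Q}_{\mathrm{red}}=\mathcal{Q}[\alpha,\alpha]-\mathcal{Q}[\alpha,\alpha^c]\mathcal{Q}[\alpha^c,\alpha^c]^{ -1}\mathcal{Q}[\alpha^c,\alpha]$, is also weight balanced.
   Context: A directed weighted graph $\mathcal{G}=([n],\mathcal{E},\mathcal{A})$ has node set $[n]$ and weighted adjacency matrix $\mathcal{A}\in\mathbb{R}^{n\times n}$ with nonnegative entries; $\mathcal{A}_{ii}>0$ means node $i$ has a self-loop. The degree matrix is $\mathcal{D}=\mathrm{diag}(\sum_j\mathcal{A}_{ij})_{i}$, the loop-less Laplacian is $\mathcal{L}=\mathcal{D}-\mathcal{A}$, and the loopy Laplacian is $\mathcal{Q}=\mathcal{L}+\mathrm{diag}(\mathcal{A}_{11},\dots,\mathcal{A}_{nn})$. Any real square matrix $Q$ with nonpositive off-diagonal entries and nonnegative row sums is the loopy Laplacian of exactly one graph, namely the one with $\mathcal{A}_{ii}=\sum_j Q_{ij}$ and $\mathcal{A}_{ij}=-Q_{ij}$ for $i\neq j$. A graph is weight balanced if $\sum_j\mathcal{A}_{ij}=\sum_j\mathcal{A}_{ji}$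 for every node $i$. $M[\beta,\gamma]$ denotes the submatrix with rows in $\beta$ and columns in $\gamma$, and $\alpha^c=[n]\setminus\alpha$. -}

module Defs where

open import Level using (Level; _⊔_) renaming (suc to lsuc)
open import Data.Nat using (ℕ; zero; suc)
open import Data.Fin using (Fin; zero; suc; _≟_)
open import Data.Fin.Subset using (Subset; _∈_; _∉_; ∁; ∣_∣)
open import Data.Bool using (Bool; true; false; if_then_else_)
open import Data.Vec using (lookup)
open import Data.Product using (∃; _×_)
open import Relation.Nullary using (¬_; does)
open import Relation.Binary.Structures using (IsTotalOrder)
open import Algebra.Bundles using (CommutativeRing)

-- An ordered field (the reals are an instance).  The paper works over ℝ;
-- the standard library has no reals, so we state the result for an
-- arbitrary ordered field.
record OrderedField (c ℓ : Level) : Set (lsuc (c ⊔ ℓ)) where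
  field
    commutativeRing : CommutativeRing c ℓ
  open CommutativeRing commutativeRing public
  field
    _≤_           : Carrier → Carrier → Set ℓ
    isTotalOrder  : IsTotalOrder _≈_ _≤_
    +-mono-≤      : ∀ {x y} z → x ≤ y → (x + z) ≤ (y + z)
    *-nonneg      : ∀ {x y} → 0# ≤ x → 0# ≤ y → 0# ≤ (x * y)
    0≉1           : ¬ (0# ≈ 1#)
    inverse       : ∀ x → ¬ (x ≈ 0#) → ∃ λ y → (x * y) ≈ 1#

module Graphs {c ℓ : Level} (F : OrderedField c ℓ) where
  open OrderedField F using (Carrier; _+_; _*_; -_; _-_; 1#; _≤_)
  open OrderedField F public using (_≈_; 0#)

  Matrix : ℕ → Set c
  Matrix n = Fin n → Fin n → Carrier

  ∑ : ∀ {n} → (Fin n → Carrier) → Carrier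
  ∑ {zero}  f = 0#
  ∑ {suc n} f = f zero + ∑ (λ i → f (suc i))

  ∑[_] : ∀ {n} → Subset n → (Fin n → Carrier) → Carrier
  ∑[ β ] f = ∑ (λ i → if lookup β i then f i else 0#)

  δ : ∀ {n} → Fin n → Fin n → Carrier
  δ i j = if does (i ≟ j) then 1# else 0#

  IsAdjacency : ∀ {n} → Matrix n → Set ℓ
  IsAdjacency A = ∀ i j → 0# ≤ A i j

  degree : ∀ {n} → Matrix n → Fin n → Carrier
  degree A i = ∑ (λ j → A i j)

  loopyLaplacian : ∀ {n} → Matrix n → Matrix n
  loopyLaplacian A i j = ((δ i j * degree A i) - A i j) + (δ i j * A i i)

  WeightBalanced : ∀ {n} → Matrix n → Set ℓ
  WeightBalanced A = ∀ i → ∑ (λ j → A i j) ≈ ∑ (λ j → A j i)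

  -- Matrices restricted to index subsets are represented by n × n arrays of
  -- which only the entries with row in β and column in γ matter.
  -- Product  (M[β,γ] N[γ,ε])_{ij} = Σ_{k ∈ γ} M_ik N_kj
  mul[_] : ∀ {n} → Subset n → Matrix n → Matrix n → Matrix n
  mul[ γ ] M N i j = ∑[ γ ] (λ k → M i k * N k j)

  IsInverseOn : ∀ {n} → Subset n → Matrix n → Matrix n → Set ℓ
  IsInverseOn {n} β M N =
    (∀ i j → i ∈ β → j ∈ β → mul[ β ] M N i j ≈ δ i j) ×
    (∀ i j → i ∈ β → j ∈ β → mul[ β ] N M i j ≈ δ i j)

  NonsingularOn : ∀ {n} → Subset n → Matrix n → Set (c ⊔ ℓ)
  NonsingularOn β M = ∃ λ N → IsInverseOn β M N

  kron : ∀ {n} → Subset n → Matrix n → Matrix n → Matrix n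
  kron α Q N i j = Q i j - mul[ ∁ α ] (mul[ ∁ α ] Q N) Q i j

  -- The unique graph on node set β with loopy Laplacian Q[β,β]:
  -- A_ii = Σ_{j ∈ β} Q_ij ,  A_ij = - Q_ij  (i ≠ j)
  adjacencyOf[_] : ∀ {n} → Subset n → Matrix n → Matrix n
  adjacencyOf[ β ] Q i j =
    if does (i ≟ j) then ∑[ β ] (λ k → Q i k) else - Q i j

  WeightBalancedOn : ∀ {n} → Subset n → Matrix n → Set ℓ
  WeightBalancedOn β A = ∀ i → i ∈ β → ∑[ β ] (λ j → A i j) ≈ ∑[ β ] (λ j → A j i)

-- Let Q be the loopy Laplacian and a the vector of self-loop weights.  Always Q 𝟙 = a,
-- and 𝟙ᵀ Q = aᵀ exactly when the graph is weight balanced.  For the Schur complement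
-- Q_red = Q[α,α] - Q[α,αᶜ] N Q[αᶜ,α], whenever x = (v, w) satisfies (Q x)[αᶜ] = 0 one has
-- Q_red v = (Q x)[α], since Q[α,αᶜ] N Q[αᶜ,α] v = - Q[α,αᶜ] N Q[αᶜ,αᶜ] w = - Q[α,αᶜ] w.
-- As a vanishes on αᶜ, x = 𝟙 qualifies, so Q_red 𝟙 = a[α]; transposing (the Kron
-- reduction of Qᵀ is Q_redᵀ) gives 𝟙ᵀ Q_red = a[α]ᵀ.  A matrix whose row and column
-- sums agree is the loopy Laplacian of a weight balanced graph.

module Submission where

open import Defs
open import Level using (Level)
open import Data.Nat using (ℕ; zero; suc; _≤_)
open import Data.Fin using (Fin; zero; suc; _≟_)
open import Data.Fin.Subset using (Subset; _∈_; _∉_; ∁; ∣_∣)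
open import Data.Bool using (true; false; not; if_then_else_)
open import Data.Vec using (lookup)
open import Data.Vec.Properties using (lookup⇒[]=; []=⇒lookup; lookup-map)
open import Data.Product using (∃; _,_)
open import Relation.Nullary using (yes; no)
open import Relation.Binary.PropositionalEquality as ≡ using (_≡_)
import Relation.Binary.Reasoning.Setoid as SetoidReasoning

module Sums {c ℓ : Level} (F : OrderedField c ℓ) where
  open OrderedField F hiding (_≤_; zero)
  open Graphs F hiding (_≈_; 0#)
  open import Algebra.Properties.Semiring.Sum semiring as Sum using (sum; sum-cong-≗)
  open import Algebra.Properties.AbelianGroup +-abelianGroup using (⁻¹-∙-comm; ε⁻¹≈ε)
  open SetoidReasoning setoid

  ∑≡sum : ∀ {n} (f : Fin n → Carrier) → ∑ f ≡ sum f
  ∑≡sum {zero}  f = ≡.refl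
  ∑≡sum {suc n} f = ≡.cong (f zero +_) (∑≡sum (λ i → f (suc i)))

  ∑∑≡sumsum : ∀ {m n} (f : Fin m → Fin n → Carrier) →
              ∑ (λ i → ∑ (f i)) ≡ sum (λ i → sum (f i))
  ∑∑≡sumsum f = ≡.trans (∑≡sum (λ i → ∑ (f i))) (sum-cong-≗ (λ i → ∑≡sum (f i)))

  ∑-cong : ∀ {n} {f g : Fin n → Carrier} → (∀ i → f i ≈ g i) → ∑ f ≈ ∑ g
  ∑-cong {f = f} {g} f≈g rewrite ∑≡sum f | ∑≡sum g = Sum.sum-cong-≋ f≈g

  ∑-zero : ∀ n → ∑ {n} (λ _ → 0#) ≈ 0#
  ∑-zero n rewrite ∑≡sum {n} (λ _ → 0#) = Sum.sum-replicate-zero n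

  ∑-distrib-+ : ∀ {n} (f g : Fin n → Carrier) → ∑ (λ i → f i + g i) ≈ ∑ f + ∑ g
  ∑-distrib-+ f g rewrite ∑≡sum (λ i → f i + g i) | ∑≡sum f | ∑≡sum g =
    Sum.∑-distrib-+ f g

  ∑-comm : ∀ {m n} (f : Fin m → Fin n → Carrier) →
           ∑ (λ i → ∑ (f i)) ≈ ∑ (λ j → ∑ (λ i → f i j))
  ∑-comm f rewrite ∑∑≡sumsum f | ∑∑≡sumsum (λ j i → f i j) = Sum.∑-comm f

  *-distribˡ-∑ : ∀ {n} x (f : Fin n → Carrier) → x * ∑ f ≈ ∑ (λ i → x * f i)
  *-distribˡ-∑ x f rewrite ∑≡sum f | ∑≡sum (λ i → x * f i) = Sum.*-distribˡ-sum x f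

  *-distribʳ-∑ : ∀ {n} x (f : Fin n → Carrier) → ∑ f * x ≈ ∑ (λ i → f i * x)
  *-distribʳ-∑ x f rewrite ∑≡sum f | ∑≡sum (λ i → f i * x) = Sum.*-distribʳ-sum x f

  ∑-neg : ∀ {n} (f : Fin n → Carrier) → ∑ (λ i → - f i) ≈ - ∑ f
  ∑-neg {zero}  f = sym ε⁻¹≈ε
  ∑-neg {suc n} f = trans (+-congˡ (∑-neg (λ i → f (suc i)))) (⁻¹-∙-comm _ _)

  ∑-sub : ∀ {n} (f g : Fin n → Carrier) → ∑ (λ i → f i - g i) ≈ ∑ f - ∑ g
  ∑-sub f g = trans (∑-distrib-+ f (λ i → - g i)) (+-congˡ (∑-neg g))

  δ-sym : ∀ {n} (i j : Fin n) → δ i j ≡ δ j i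
  δ-sym zero    zero    = ≡.refl
  δ-sym zero    (suc j) = ≡.refl
  δ-sym (suc i) zero    = ≡.refl
  δ-sym (suc i) (suc j) = δ-sym i j

  ∑-δˡ : ∀ {n} (i : Fin n) (f : Fin n → Carrier) → ∑ (λ j → δ i j * f j) ≈ f i
  ∑-δˡ {suc n} zero f = begin
    1# * f zero + ∑ (λ j → 0# * f (suc j)) ≈⟨ +-cong (*-identityˡ _) (∑-cong {n} (λ _ → zeroˡ _)) ⟩
    f zero + ∑ {n} (λ _ → 0#)              ≈⟨ +-congˡ (∑-zero n) ⟩
    f zero + 0#                            ≈⟨ +-identityʳ _ ⟩
    f zero                                 ∎
  ∑-δˡ {suc n} (suc i) f =
    trans (+-cong (zeroˡ _) (∑-δˡ i (λ j → f (suc j)))) (+-identityˡ _)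

  ∑-δʳ : ∀ {n} (i : Fin n) (f : Fin n → Carrier) → ∑ (λ j → δ j i * f j) ≈ f i
  ∑-δʳ i f =
    trans (∑-cong (λ j → reflexive (≡.cong (λ d → d * f j) (δ-sym j i)))) (∑-δˡ i f)

  if-*ˡ : ∀ b x y → x * (if b then y else 0#) ≈ (if b then x * y else 0#)
  if-*ˡ true  x y = refl
  if-*ˡ false x y = zeroʳ x

  if-*ʳ : ∀ b x y → (if b then y else 0#) * x ≈ (if b then y * x else 0#)
  if-*ʳ true  x y = refl
  if-*ʳ false x y = zeroˡ x

  if-∑ : ∀ {n} b (f : Fin n → Carrier) →
         (if b then ∑ f else 0#) ≈ ∑ (λ j → if b then f j else 0#)
  if-∑ true  f = refl
  if-∑ {n} false f = sym (∑-zero n)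

  ∑[]-cong-∈ : ∀ {n} (β : Subset n) {f g : Fin n → Carrier} →
               (∀ i → i ∈ β → f i ≈ g i) → ∑[ β ] f ≈ ∑[ β ] g
  ∑[]-cong-∈ β {f} {g} f≈g = ∑-cong restricted
    where
    restricted : ∀ i → (if lookup β i then f i else 0#) ≈ (if lookup β i then g i else 0#)
    restricted i with lookup β i in eq
    ... | true  = f≈g i (lookup⇒[]= i β eq)
    ... | false = refl

  ∑-split : ∀ {n} (β : Subset n) (f : Fin n → Carrier) → ∑ f ≈ ∑[ β ] f + ∑[ ∁ β ] f
  ∑-split {n} β f = trans (∑-cong parts) (∑-distrib-+ {n} _ _)
    where
    parts : ∀ i → f i ≈ (if lookup β i then f i else 0#) + (if lookup (∁ β) i then f i else 0#)
    parts i rewrite lookup-map i not β with lookup β i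
    ... | true  = sym (+-identityʳ _)
    ... | false = sym (+-identityˡ _)

  ∑[]-zero : ∀ {n} (β : Subset n) → ∑[ β ] (λ _ → 0#) ≈ 0#
  ∑[]-zero {n} β = trans (∑-cong restricted) (∑-zero n)
    where
    restricted : ∀ i → (if lookup β i then 0# else 0#) ≈ 0#
    restricted i with lookup β i
    ... | true  = refl
    ... | false = refl

  ∑[]-distrib-+ : ∀ {n} (β : Subset n) (f g : Fin n → Carrier) →
                  ∑[ β ] (λ i → f i + g i) ≈ ∑[ β ] f + ∑[ β ] g
  ∑[]-distrib-+ {n} β f g = trans (∑-cong restricted) (∑-distrib-+ {n} _ _)
    where
    restricted : ∀ i → (if lookup β i then f i + g i else 0#) ≈
                       (if lookup β i then f i else 0#) + (if lookup β i then g i else 0#)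
    restricted i with lookup β i
    ... | true  = refl
    ... | false = sym (+-identityˡ 0#)

  ∑[]-neg : ∀ {n} (β : Subset n) (f : Fin n → Carrier) → ∑[ β ] (λ i → - f i) ≈ - ∑[ β ] f
  ∑[]-neg {n} β f = trans (∑-cong restricted) (∑-neg {n} _)
    where
    restricted : ∀ i → (if lookup β i then - f i else 0#) ≈ - (if lookup β i then f i else 0#)
    restricted i with lookup β i
    ... | true  = refl
    ... | false = sym ε⁻¹≈ε

  *-distribˡ-∑[] : ∀ {n} (β : Subset n) x (f : Fin n → Carrier) →
                   x * ∑[ β ] f ≈ ∑[ β ] (λ i → x * f i)
  *-distribˡ-∑[] {n} β x f =
    trans (*-distribˡ-∑ {n} x _) (∑-cong (λ i → if-*ˡ (lookup β i) x (f i)))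

  *-distribʳ-∑[] : ∀ {n} (β : Subset n) x (f : Fin n → Carrier) →
                   ∑[ β ] f * x ≈ ∑[ β ] (λ i → f i * x)
  *-distribʳ-∑[] {n} β x f =
    trans (*-distribʳ-∑ {n} x _) (∑-cong (λ i → if-*ʳ (lookup β i) x (f i)))

  ∑[]-comm : ∀ {n} (β γ : Subset n) (f : Fin n → Fin n → Carrier) →
             ∑[ β ] (λ i → ∑[ γ ] (f i)) ≈ ∑[ γ ] (λ j → ∑[ β ] (λ i → f i j))
  ∑[]-comm {n} β γ f = begin
    ∑ (λ i → if lookup β i then ∑ (λ j → if lookup γ j then f i j else 0#) else 0#)
      ≈⟨ ∑-cong (λ i → if-∑ {n} (lookup β i) _) ⟩
    ∑ (λ i → ∑ (λ j → if lookup β i then (if lookup γ j then f i j else 0#) else 0#))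
      ≈⟨ ∑-comm {n} {n} _ ⟩
    ∑ (λ j → ∑ (λ i → if lookup β i then (if lookup γ j then f i j else 0#) else 0#))
      ≈⟨ ∑-cong (λ j → ∑-cong (λ i → reflexive (if-swap (lookup β i) (lookup γ j)))) ⟩
    ∑ (λ j → ∑ (λ i → if lookup γ j then (if lookup β i then f i j else 0#) else 0#))
      ≈⟨ ∑-cong (λ j → sym (if-∑ {n} (lookup γ j) _)) ⟩
    ∑ (λ j → if lookup γ j then ∑ (λ i → if lookup β i then f i j else 0#) else 0#) ∎
    where
    if-swap : ∀ b b′ {x} → (if b then (if b′ then x else 0#) else 0#) ≡
                           (if b′ then (if b then x else 0#) else 0#)
    if-swap true  b′    = ≡.refl
    if-swap false true  = ≡.refl
    if-swap false false = ≡.refl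

  ∑[]-δˡ : ∀ {n} (β : Subset n) {i} (f : Fin n → Carrier) → i ∈ β →
           ∑[ β ] (λ j → δ i j * f j) ≈ f i
  ∑[]-δˡ β {i} f i∈β = begin
    ∑ (λ j → if lookup β j then δ i j * f j else 0#)
      ≈⟨ ∑-cong (λ j → sym (if-*ˡ (lookup β j) (δ i j) (f j))) ⟩
    ∑ (λ j → δ i j * (if lookup β j then f j else 0#))
      ≈⟨ ∑-δˡ i _ ⟩
    (if lookup β i then f i else 0#)
      ≡⟨ ≡.cong (if_then f i else 0#) ([]=⇒lookup i∈β) ⟩
    f i ∎

  ∑[]-δʳ : ∀ {n} (β : Subset n) {i} (f : Fin n → Carrier) → i ∈ β →
           ∑[ β ] (λ j → δ j i * f j) ≈ f i
  ∑[]-δʳ β {i} f i∈β =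
    trans (∑[]-cong-∈ β (λ j _ → reflexive (≡.cong (λ d → d * f j) (δ-sym j i))))
          (∑[]-δˡ β f i∈β)

module SubMatrices {c ℓ : Level} (F : OrderedField c ℓ) where
  open OrderedField F hiding (_≤_; zero)
  open Graphs F hiding (_≈_; 0#)
  open Sums F
  open import Algebra.Properties.Ring ring using (-‿distribˡ-*)
  open SetoidReasoning setoid

  mulVec[_] : ∀ {n} → Subset n → Matrix n → (Fin n → Carrier) → Fin n → Carrier
  mulVec[ γ ] M v i = ∑[ γ ] (λ k → M i k * v k)

  _ᵀ : ∀ {n} → Matrix n → Matrix n
  (M ᵀ) i j = M j i

  RightInverseOn LeftInverseOn : ∀ {n} → Subset n → Matrix n → Matrix n → Set ℓ
  RightInverseOn β M N = ∀ i j → i ∈ β → j ∈ β → mul[ β ] M N i j ≈ δ i j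
  LeftInverseOn  β M N = ∀ i j → i ∈ β → j ∈ β → mul[ β ] N M i j ≈ δ i j

  mulVec-cong-∈ : ∀ {n} (γ : Subset n) (M : Matrix n) {v w : Fin n → Carrier} →
                  (∀ k → k ∈ γ → v k ≈ w k) → ∀ i → mulVec[ γ ] M v i ≈ mulVec[ γ ] M w i
  mulVec-cong-∈ γ M v≈w i = ∑[]-cong-∈ γ (λ k k∈γ → *-congˡ (v≈w k k∈γ))

  mulVec-distrib-+ : ∀ {n} (γ : Subset n) (M : Matrix n) (v w : Fin n → Carrier) i →
                     mulVec[ γ ] M (λ k → v k + w k) i ≈ mulVec[ γ ] M v i + mulVec[ γ ] M w i
  mulVec-distrib-+ γ M v w i =
    trans (∑[]-cong-∈ γ (λ k _ → distribˡ _ _ _)) (∑[]-distrib-+ γ _ _)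

  mulVec-zero : ∀ {n} (γ : Subset n) (M : Matrix n) i → mulVec[ γ ] M (λ _ → 0#) i ≈ 0#
  mulVec-zero γ M i = trans (∑[]-cong-∈ γ (λ k _ → zeroʳ _)) (∑[]-zero γ)

  mulVec-sub : ∀ {n} (γ : Subset n) (M X : Matrix n) (v : Fin n → Carrier) i →
               mulVec[ γ ] (λ i j → M i j - X i j) v i ≈ mulVec[ γ ] M v i - mulVec[ γ ] X v i
  mulVec-sub γ M X v i = begin
    ∑[ γ ] (λ k → (M i k - X i k) * v k)
      ≈⟨ ∑[]-cong-∈ γ (λ k _ → trans (distribʳ (v k) (M i k) (- X i k))
                                     (+-congˡ (sym (-‿distribˡ-* (X i k) (v k))))) ⟩
    ∑[ γ ] (λ k → M i k * v k + - (X i k * v k))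
      ≈⟨ ∑[]-distrib-+ γ _ _ ⟩
    mulVec[ γ ] M v i + ∑[ γ ] (λ k → - (X i k * v k))
      ≈⟨ +-congˡ (∑[]-neg γ _) ⟩
    mulVec[ γ ] M v i - mulVec[ γ ] X v i ∎

  mulVec-mul : ∀ {n} (β γ : Subset n) (M X : Matrix n) (v : Fin n → Carrier) i →
               mulVec[ β ] (mul[ γ ] M X) v i ≈ mulVec[ γ ] M (mulVec[ β ] X v) i
  mulVec-mul β γ M X v i = begin
    ∑[ β ] (λ j → ∑[ γ ] (λ k → M i k * X k j) * v j)
      ≈⟨ ∑[]-cong-∈ β (λ j _ → *-distribʳ-∑[] γ (v j) _) ⟩
    ∑[ β ] (λ j → ∑[ γ ] (λ k → (M i k * X k j) * v j))
      ≈⟨ ∑[]-comm β γ _ ⟩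
    ∑[ γ ] (λ k → ∑[ β ] (λ j → (M i k * X k j) * v j))
      ≈⟨ ∑[]-cong-∈ γ (λ k _ → ∑[]-cong-∈ β (λ j _ → *-assoc _ _ _)) ⟩
    ∑[ γ ] (λ k → ∑[ β ] (λ j → M i k * (X k j * v j)))
      ≈⟨ ∑[]-cong-∈ γ (λ k _ → sym (*-distribˡ-∑[] β (M i k) _)) ⟩
    ∑[ γ ] (λ k → M i k * ∑[ β ] (λ j → X k j * v j)) ∎

  mulVec-leftInverse : ∀ {n} (γ : Subset n) {M N : Matrix n} → LeftInverseOn γ M N →
                       (v : Fin n → Carrier) → ∀ {k} → k ∈ γ →
                       mulVec[ γ ] (mul[ γ ] N M) v k ≈ v k
  mulVec-leftInverse γ NM≈I v {k} k∈γ =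
    trans (∑[]-cong-∈ γ (λ j j∈γ → *-congʳ (NM≈I k j k∈γ j∈γ))) (∑[]-δˡ γ v k∈γ)

  mul[]-assoc : ∀ {n} (γ : Subset n) (M X Y : Matrix n) i j →
                mul[ γ ] (mul[ γ ] M X) Y i j ≈ mul[ γ ] M (mul[ γ ] X Y) i j
  mul[]-assoc γ M X Y i j = mulVec-mul γ γ M X (λ k → Y k j) i

  mul[]-ᵀ : ∀ {n} (γ : Subset n) (M X : Matrix n) i j →
            mul[ γ ] M X j i ≈ mul[ γ ] (X ᵀ) (M ᵀ) i j
  mul[]-ᵀ γ M X i j = ∑[]-cong-∈ γ (λ k _ → *-comm (M j k) (X k i))

  rightInverse⇒leftInverseᵀ : ∀ {n} (β : Subset n) {M N : Matrix n} →
                              RightInverseOn β M N → LeftInverseOn β (M ᵀ) (N ᵀ)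
  rightInverse⇒leftInverseᵀ β {M} {N} MN≈I i j i∈β j∈β =
    trans (sym (mul[]-ᵀ β M N i j)) (trans (MN≈I j i j∈β i∈β) (reflexive (δ-sym j i)))

module KronReduction {c ℓ : Level} (F : OrderedField c ℓ) where
  open OrderedField F hiding (_≤_; zero)
  open Graphs F hiding (_≈_; 0#)
  open Sums F
  open SubMatrices F
  open import Algebra.Properties.AbelianGroup +-abelianGroup using (inverseʳ-unique)
  open SetoidReasoning setoid

  kron-mulVec : ∀ {n} (α : Subset n) (Q N : Matrix n) → LeftInverseOn (∁ α) Q N →
                (v w : Fin n → Carrier) →
                (∀ k → k ∈ ∁ α → mulVec[ α ] Q v k + mulVec[ ∁ α ] Q w k ≈ 0#) →
                ∀ i → mulVec[ α ] (kron α Q N) v i ≈ mulVec[ α ] Q v i + mulVec[ ∁ α ] Q w i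
  kron-mulVec α Q N NQ≈I v w Qx≈0 i = begin
    mulVec[ α ] (kron α Q N) v i
      ≈⟨ mulVec-sub α Q (mul[ γ ] QN Q) v i ⟩
    mulVec[ α ] Q v i - mulVec[ α ] (mul[ γ ] QN Q) v i
      ≈⟨ +-congˡ (sym (inverseʳ-unique _ _ correction)) ⟩
    mulVec[ α ] Q v i + mulVec[ γ ] Q w i ∎
    where
    γ = ∁ α
    QN = mul[ γ ] Q N

    Qw≈QNQw : mulVec[ γ ] Q w i ≈ mulVec[ γ ] QN (mulVec[ γ ] Q w) i
    Qw≈QNQw = begin
      mulVec[ γ ] Q w i
        ≈⟨ mulVec-cong-∈ γ Q (λ k k∈γ → sym (mulVec-leftInverse γ NQ≈I w k∈γ)) i ⟩
      mulVec[ γ ] Q (mulVec[ γ ] (mul[ γ ] N Q) w) i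
        ≈⟨ mulVec-cong-∈ γ Q (λ k _ → mulVec-mul γ γ N Q w k) i ⟩
      mulVec[ γ ] Q (mulVec[ γ ] N (mulVec[ γ ] Q w)) i
        ≈⟨ mulVec-mul γ γ Q N (mulVec[ γ ] Q w) i ⟨
      mulVec[ γ ] QN (mulVec[ γ ] Q w) i ∎

    correction : mulVec[ α ] (mul[ γ ] QN Q) v i + mulVec[ γ ] Q w i ≈ 0#
    correction = begin
      mulVec[ α ] (mul[ γ ] QN Q) v i + mulVec[ γ ] Q w i
        ≈⟨ +-cong (mulVec-mul α γ QN Q v i) Qw≈QNQw ⟩
      mulVec[ γ ] QN (mulVec[ α ] Q v) i + mulVec[ γ ] QN (mulVec[ γ ] Q w) i
        ≈⟨ mulVec-distrib-+ γ QN _ _ i ⟨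
      mulVec[ γ ] QN (λ k → mulVec[ α ] Q v k + mulVec[ γ ] Q w k) i
        ≈⟨ mulVec-cong-∈ γ QN Qx≈0 i ⟩
      mulVec[ γ ] QN (λ _ → 0#) i
        ≈⟨ mulVec-zero γ QN i ⟩
      0# ∎

  kron-rowSum : ∀ {n} (α : Subset n) (Q N : Matrix n) → LeftInverseOn (∁ α) Q N →
                (∀ k → k ∈ ∁ α → ∑ (Q k) ≈ 0#) →
                ∀ i → ∑[ α ] (kron α Q N i) ≈ ∑ (Q i)
  kron-rowSum α Q N NQ≈I Q𝟙≈0 i = begin
    ∑[ α ] (kron α Q N i)
      ≈⟨ mulVec-𝟙 α (kron α Q N) i ⟨
    mulVec[ α ] (kron α Q N) 𝟙 i
      ≈⟨ kron-mulVec α Q N NQ≈I 𝟙 𝟙 (λ k k∈αᶜ → trans (split k) (Q𝟙≈0 k k∈αᶜ)) i ⟩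
    mulVec[ α ] Q 𝟙 i + mulVec[ ∁ α ] Q 𝟙 i
      ≈⟨ split i ⟩
    ∑ (Q i) ∎
    where
    𝟙 : Fin _ → Carrier
    𝟙 _ = 1#

    mulVec-𝟙 : ∀ β (M : Matrix _) k → mulVec[ β ] M 𝟙 k ≈ ∑[ β ] (M k)
    mulVec-𝟙 β M k = ∑[]-cong-∈ β (λ j _ → *-identityʳ (M k j))

    split : ∀ k → mulVec[ α ] Q 𝟙 k + mulVec[ ∁ α ] Q 𝟙 k ≈ ∑ (Q k)
    split k = trans (+-cong (mulVec-𝟙 α Q k) (mulVec-𝟙 (∁ α) Q k)) (sym (∑-split α (Q k)))

  kron-ᵀ : ∀ {n} (α : Subset n) (Q N : Matrix n) i j →
           kron α (Q ᵀ) (N ᵀ) i j ≈ kron α Q N j i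
  kron-ᵀ α Q N i j = +-congˡ (-‿cong (begin
    mul[ γ ] (mul[ γ ] (Q ᵀ) (N ᵀ)) (Q ᵀ) i j
      ≈⟨ mul[]-ᵀ γ Q (mul[ γ ] (Q ᵀ) (N ᵀ) ᵀ) i j ⟨
    mul[ γ ] Q (mul[ γ ] (Q ᵀ) (N ᵀ) ᵀ) j i
      ≈⟨ ∑[]-cong-∈ γ (λ k _ → *-congˡ (mul[]-ᵀ γ N Q i k)) ⟨
    mul[ γ ] Q (mul[ γ ] N Q) j i
      ≈⟨ mul[]-assoc γ Q N Q j i ⟨
    mul[ γ ] (mul[ γ ] Q N) Q j i ∎))
    where
    γ = ∁ α

  kron-colSum : ∀ {n} (α : Subset n) (Q N : Matrix n) → RightInverseOn (∁ α) Q N →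
                (∀ k → k ∈ ∁ α → ∑ (λ i → Q i k) ≈ 0#) →
                ∀ j → ∑[ α ] (λ i → kron α Q N i j) ≈ ∑ (λ i → Q i j)
  kron-colSum α Q N QN≈I 𝟙Q≈0 j =
    trans (∑[]-cong-∈ α (λ i _ → sym (kron-ᵀ α Q N j i)))
          (kron-rowSum α (Q ᵀ) (N ᵀ) (rightInverse⇒leftInverseᵀ (∁ α) QN≈I) 𝟙Q≈0 j)

module LoopyGraphs {c ℓ : Level} (F : OrderedField c ℓ) where
  open OrderedField F hiding (_≤_; zero)
  open Graphs F hiding (_≈_; 0#)
  open Sums F
  open import Algebra.Properties.AbelianGroup +-abelianGroup using (∙-cancelʳ)
  open SetoidReasoning setoid

  sub-self-+ : ∀ {x y} z → x ≈ y → (x - y) + z ≈ z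
  sub-self-+ {x} {y} z x≈y =
    trans (+-congʳ (trans (+-congʳ x≈y) (-‿inverseʳ y))) (+-identityˡ z)

  loopyLaplacian-rowSum : ∀ {n} (A : Matrix n) i → ∑ (loopyLaplacian A i) ≈ A i i
  loopyLaplacian-rowSum {n} A i = begin
    ∑ (λ j → (δ i j * degree A i - A i j) + δ i j * A i i)
      ≈⟨ ∑-distrib-+ {n} _ _ ⟩
    ∑ (λ j → δ i j * degree A i - A i j) + ∑ (λ j → δ i j * A i i)
      ≈⟨ +-cong (∑-sub {n} _ _) (∑-δˡ i _) ⟩
    (∑ (λ j → δ i j * degree A i) - degree A i) + A i i
      ≈⟨ sub-self-+ (A i i) (∑-δˡ i _) ⟩
    A i i ∎

  loopyLaplacian-colSum : ∀ {n} (A : Matrix n) → WeightBalanced A →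
                          ∀ j → ∑ (λ i → loopyLaplacian A i j) ≈ A j j
  loopyLaplacian-colSum {n} A balanced j = begin
    ∑ (λ i → (δ i j * degree A i - A i j) + δ i j * A i i)
      ≈⟨ ∑-distrib-+ {n} _ _ ⟩
    ∑ (λ i → δ i j * degree A i - A i j) + ∑ (λ i → δ i j * A i i)
      ≈⟨ +-cong (∑-sub {n} _ _) (∑-δʳ j _) ⟩
    (∑ (λ i → δ i j * degree A i) - ∑ (λ i → A i j)) + A j j
      ≈⟨ sub-self-+ (A j j) (trans (∑-δʳ j _) (balanced j)) ⟩
    A j j ∎

  adjacencyOf-+ : ∀ {n} (β : Subset n) (R : Matrix n) i j →
                  adjacencyOf[ β ] R i j + R i j ≈ δ i j * (∑[ β ] (R i) + R i i)
  adjacencyOf-+ β R i j with i ≟ j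
  ... | yes ≡.refl = sym (*-identityˡ _)
  ... | no _       = trans (-‿inverseˡ (R i j)) (sym (zeroˡ _))

  adjacencyOf-weightBalanced : ∀ {n} (β : Subset n) (R : Matrix n) →
                               (∀ i → i ∈ β → ∑[ β ] (R i) ≈ ∑[ β ] (λ j → R j i)) →
                               WeightBalancedOn β (adjacencyOf[ β ] R)
  adjacencyOf-weightBalanced β R rowSum≈colSum i i∈β = ∙-cancelʳ (∑[ β ] (R i)) _ _ (begin
    ∑[ β ] (adjacencyOf[ β ] R i) + ∑[ β ] (R i)
      ≈⟨ ∑[]-distrib-+ β _ _ ⟨
    ∑[ β ] (λ j → adjacencyOf[ β ] R i j + R i j)
      ≈⟨ ∑[]-cong-∈ β (λ j _ → adjacencyOf-+ β R i j) ⟩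
    ∑[ β ] (λ j → δ i j * loop i)
      ≈⟨ ∑[]-δˡ β (λ _ → loop i) i∈β ⟩
    loop i
      ≈⟨ ∑[]-δʳ β loop i∈β ⟨
    ∑[ β ] (λ j → δ j i * loop j)
      ≈⟨ ∑[]-cong-∈ β (λ j _ → adjacencyOf-+ β R j i) ⟨
    ∑[ β ] (λ j → adjacencyOf[ β ] R j i + R j i)
      ≈⟨ ∑[]-distrib-+ β _ _ ⟩
    ∑[ β ] (λ j → adjacencyOf[ β ] R j i) + ∑[ β ] (λ j → R j i)
      ≈⟨ +-congˡ (rowSum≈colSum i i∈β) ⟨
    ∑[ β ] (λ j → adjacencyOf[ β ] R j i) + ∑[ β ] (R i) ∎)
    where
    loop : Fin _ → Carrier
    loop k = ∑[ β ] (R k) + R k k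

theorem3p11 : {c ℓ : Level} (F : OrderedField c ℓ) → let open Graphs F in
    (n : ℕ) (A : Matrix n) → IsAdjacency A → WeightBalanced A →
    (α : Subset n) → (∃ λ i → i ∉ α) → 2 ≤ ∣ α ∣ →
    NonsingularOn (∁ α) (loopyLaplacian A) →
    (∀ i → i ∈ ∁ α → A i i ≈ 0#) →
    (N : Matrix n) → IsInverseOn (∁ α) (loopyLaplacian A) N →
    WeightBalancedOn α (adjacencyOf[ α ] (kron α (loopyLaplacian A) N))
theorem3p11 F n A _ balanced α _ _ _ noLoops N (QN≈I , NQ≈I) =
  adjacencyOf-weightBalanced α R λ i _ → begin
    ∑[ α ] (R i)          ≈⟨ kron-rowSum α Q N NQ≈I eliminatedRowSums i ⟩
    ∑ (Q i)               ≈⟨ loopyLaplacian-rowSum A i ⟩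
    A i i                 ≈⟨ loopyLaplacian-colSum A balanced i ⟨
    ∑ (λ k → Q k i)       ≈⟨ kron-colSum α Q N QN≈I eliminatedColSums i ⟨
    ∑[ α ] (λ k → R k i)  ∎
  where
  open OrderedField F using (setoid; trans)
  open Graphs F
  open KronReduction F
  open LoopyGraphs F
  open SetoidReasoning setoid

  Q R : Matrix n
  Q = loopyLaplacian A
  R = kron α Q N

  eliminatedRowSums : ∀ k → k ∈ ∁ α → ∑ (Q k) ≈ 0#
  eliminatedRowSums k k∈αᶜ = trans (loopyLaplacian-rowSum A k) (noLoops k k∈αᶜ)

  eliminatedColSums : ∀ k → k ∈ ∁ α → ∑ (λ i → Q i k) ≈ 0#
  eliminatedColSums k k∈αᶜ = trans (loopyLaplacian-colSum A balanced k) (noLoops k k∈αᶜ)
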